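{- For $m\ge0$ let $D_m(q)=\sum q^{\mathrm{area}(F)}$, the sum over all Ferrers diagrams $F$ (including the empty diagram) whose half-perimeter (width plus height) is at most $m$; thus $D_0(q)=D_1(q)=1$. Then (a) $D_m(q)=D_{m-1}(q)+q^{m-1}\sum_{h=0}^{m-2}D_h(q)$ for $m\ge1$; (b) $D_m(q)=(1+q)D_{m-1}(q)+(q^{m-1}-q)D_{m-2}(q)$ for $m\ge2$.
   Context: A Ferrers diagram is the diagram of an integer partition (a left-justified pile of rows of weakly decreasing lengths); the empty diagram has half-perimeter $0$ and area $0$. -}

module Defs where

open import Level using (Level)
open import Data.Nat using (ℕ; zero; suc; _+_; _≤_; _≥_; _<_; _⊔_; _≤?_; _≥?_; _<?_)
open import Data.List using (List; []; _∷_; map; concatMap; upTo; length; foldr; filter)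
open import Data.Nat.ListAction using (sum)
open import Data.List.Relation.Unary.All using (All; all?)
open import Data.List.Relation.Unary.Linked using (Linked; linked?)
open import Data.Product using (_×_)
open import Relation.Nullary using (Dec)
open import Relation.Nullary.Decidable using (_×-dec_)
open import Algebra.Bundles using (CommutativeRing; Semiring)
import Algebra.Definitions.RawSemiring as RawSemiringDefs

-- A Ferrers diagram is represented by its list of row lengths (the parts of
-- an integer partition): every row is nonempty and the rows weakly decrease.
-- The empty list is the empty diagram.
Diagram : Set
Diagram = List ℕ

IsFerrers : Diagram → Set
IsFerrers F = All (0 <_) F × Linked _≥_ F

isFerrers? : (F : Diagram) → Dec (IsFerrers F)
isFerrers? F = all? (0 <?_) F ×-dec linked? _≥?_ F

width : Diagram → ℕ
width = foldr _⊔_ 0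

height : Diagram → ℕ
height = length

area : Diagram → ℕ
area = sum

halfPerimeter : Diagram → ℕ
halfPerimeter F = width F + height F

listsOf : ℕ → ℕ → List Diagram
listsOf m zero    = [] ∷ []
listsOf m (suc ℓ) = concatMap (λ x → map (x ∷_) (listsOf m ℓ)) (upTo (suc m))

-- all lists of length ≤ m with entries ≤ m (a superset of the diagrams with
-- half-perimeter ≤ m, each listed exactly once)
candidates : ℕ → List Diagram
candidates m = concatMap (listsOf m) (upTo (suc m))

ferrersUpTo : ℕ → List Diagram
ferrersUpTo m = filter (λ F → isFerrers? F ×-dec (halfPerimeter F ≤? m)) (candidates m)

module _ {c ℓ : Level} (R : CommutativeRing c ℓ) where
  open CommutativeRing R hiding (_+_)
  open CommutativeRing R using () renaming (_+_ to _+R_)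
  open RawSemiringDefs (Semiring.rawSemiring semiring) using (_^_)

  pow : Carrier → ℕ → Carrier
  pow = _^_

  D : Carrier → ℕ → Carrier
  D q m = foldr (λ F acc → q ^ area F +R acc) 0# (ferrersUpTo m)

  sumD : Carrier → ℕ → Carrier
  sumD q n = foldr (λ h acc → D q h +R acc) 0# (upTo n)

-- Group the diagrams by their number of rows: D_m = Σ_{i+j=m} P(i,j), where P(i,j) counts
-- diagrams with exactly i rows, all of length ≤ j.  Splitting off the longest row gives
-- Pascal-type recurrences for P and for the box counts B(i,j) (at most i rows of length ≤ j),
-- and removing the first column gives P(i,j+1) = q^i B(i,j).  A nonempty diagram of
-- half-perimeter exactly m+1 is a hook of m cells plus a diagram in an i × j box with
-- i+j = m-1, so D_{m+1} - D_m = q^m Σ_{i+j=m-1} B(i,j); and Σ_{i+j=k} B(i,j) = Σ_{h≤k} D_h,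
-- because a diagram of half-perimeter h ≤ k fits into exactly k-h+1 of these boxes.  Subtracting (a) at m from (a) at m+1 eliminates the partial sums and gives (b).
module Submission where

open import Defs
open import Data.Nat using (ℕ; suc)
open import Data.Product using (_×_)
open import Algebra.Bundles using (CommutativeRing)

open import Algebra.Bundles using (Semiring; CommutativeSemiring)
open import Data.List using (List; []; _∷_; _++_; foldr; map; concatMap; filter; upTo; length)
open import Data.List.Properties using (upTo-∷ʳ; map-upTo; foldr-preservesᵇ)
open import Data.List.Relation.Unary.All as All using (All; []; _∷_)
open import Data.List.Relation.Unary.All.Properties using (applyUpTo⁺₁; applyUpTo⁺₂; concat⁺; map⁺)
open import Data.List.Relation.Unary.Linked as Linked using (Linked; []; [-]; _∷_)
open import Data.List.Relation.Unary.Linked.Properties using (Linked⇒All)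
open import Data.Nat as ℕ using (zero; _∸_; _≤_; _<_; _≥_; _≤?_; _<?_; z≤n; s≤s)
open import Data.Nat.Properties
  using (m≤n⇒m<n∨m≡n; ≤⇒≯; ≤-refl; ≤-trans; ⊔-lub; m≤m⊔n; m∸n≤m; m+n≤o⇒m≤o∸n; m≤o∸n⇒m+n≤o)
import Data.Nat.Properties as ℕ
open import Data.Product using (_,_; proj₂; map₂)
open import Data.Sum using (inj₁; inj₂)
open import Function using (id; _∘_; flip; _⇔_; mk⇔; Equivalence)
open import Level using (Level)
open import Relation.Binary.PropositionalEquality as ≡ using (_≡_)
open import Relation.Nullary using (Dec; yes; no; ¬_; contradiction)
open import Relation.Nullary.Decidable using (_×-dec_)
open import Relation.Unary using (Decidable)

module SemiringSums {c ℓ} (S : Semiring c ℓ) where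
  open Semiring S
  open import Relation.Binary.Reasoning.Setoid setoid
  open import Algebra.Properties.CommutativeSemigroup +-commutativeSemigroup using (interchange)

  private
    variable
      a p : Level
      A B : Set a
      P Q : Set p

  ∑ : (A → Carrier) → List A → Carrier
  ∑ f = foldr (λ x acc → f x + acc) 0#

  infix 5 ∑
  syntax ∑ (λ x → e) xs = ∑[ x ∈ xs ] e

  ∑-cong : {f g : A → Carrier} {xs : List A} → All (λ x → f x ≈ g x) xs → ∑ f xs ≈ ∑ g xs
  ∑-cong []           = refl
  ∑-cong (fx≈gx ∷ ps) = +-cong fx≈gx (∑-cong ps)

  ∑-zero : (xs : List A) → ∑[ x ∈ xs ] 0# ≈ 0#
  ∑-zero []       = refl
  ∑-zero (x ∷ xs) = trans (+-identityˡ _) (∑-zero xs)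

  ∑-++ : (f : A → Carrier) (xs ys : List A) → ∑ f (xs ++ ys) ≈ ∑ f xs + ∑ f ys
  ∑-++ f []       ys = sym (+-identityˡ _)
  ∑-++ f (x ∷ xs) ys = trans (+-congˡ (∑-++ f xs ys)) (sym (+-assoc _ _ _))

  ∑-concatMap : (f : B → Carrier) (g : A → List B) (xs : List A) →
                ∑ f (concatMap g xs) ≈ ∑[ x ∈ xs ] ∑ f (g x)
  ∑-concatMap f g []       = refl
  ∑-concatMap f g (x ∷ xs) = trans (∑-++ f (g x) (concatMap g xs)) (+-congˡ (∑-concatMap f g xs))

  ∑-map : (f : B → Carrier) (g : A → B) (xs : List A) → ∑ f (map g xs) ≡ ∑[ x ∈ xs ] f (g x)
  ∑-map f g []       = ≡.refl
  ∑-map f g (x ∷ xs) = ≡.cong (f (g x) +_) (∑-map f g xs)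

  *-distribˡ-∑ : ∀ y (f : A → Carrier) (xs : List A) → y * ∑ f xs ≈ ∑[ x ∈ xs ] y * f x
  *-distribˡ-∑ y f []       = zeroʳ y
  *-distribˡ-∑ y f (x ∷ xs) = trans (distribˡ y (f x) (∑ f xs)) (+-congˡ (*-distribˡ-∑ y f xs))

  ∑-upTo-sucʳ : (f : ℕ → Carrier) (n : ℕ) → ∑ f (upTo (suc n)) ≈ ∑ f (upTo n) + f n
  ∑-upTo-sucʳ f n = begin
    ∑ f (upTo (suc n))         ≡⟨ ≡.cong (∑ f) (≡.sym (upTo-∷ʳ n)) ⟩
    ∑ f (upTo n ++ n ∷ [])     ≈⟨ ∑-++ f (upTo n) (n ∷ []) ⟩
    ∑ f (upTo n) + (f n + 0#)  ≈⟨ +-congˡ (+-identityʳ (f n)) ⟩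
    ∑ f (upTo n) + f n         ∎

  ∑-upTo-sucˡ : (f : ℕ → Carrier) (n : ℕ) → ∑ f (upTo (suc n)) ≡ f 0 + ∑ (f ∘ suc) (upTo n)
  ∑-upTo-sucˡ f n =
    ≡.cong (f 0 +_) (≡.trans (≡.cong (∑ f) (≡.sym (map-upTo suc n))) (∑-map f suc (upTo n)))

  infixr 5 𝟙[_]_

  𝟙[_]_ : Dec P → Carrier → Carrier
  𝟙[ yes _ ] x = x
  𝟙[ no _  ] x = 0#

  𝟙-yes : (P? : Dec P) {x : Carrier} → P → 𝟙[ P? ] x ≈ x
  𝟙-yes (yes _) _ = refl
  𝟙-yes (no ¬p) p = contradiction p ¬p

  𝟙-no : (P? : Dec P) {x : Carrier} → ¬ P → 𝟙[ P? ] x ≈ 0#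
  𝟙-no (yes p) ¬p = contradiction p ¬p
  𝟙-no (no _)  _  = refl

  𝟙-cong : (P? : Dec P) {x y : Carrier} → x ≈ y → 𝟙[ P? ] x ≈ 𝟙[ P? ] y
  𝟙-cong (yes _) x≈y = x≈y
  𝟙-cong (no _)  _   = refl

  𝟙-⇔ : (P? : Dec P) (Q? : Dec Q) {x : Carrier} → P ⇔ Q → 𝟙[ P? ] x ≈ 𝟙[ Q? ] x
  𝟙-⇔ (yes p) Q? P⇔Q = sym (𝟙-yes Q? (Equivalence.to P⇔Q p))
  𝟙-⇔ (no ¬p) Q? P⇔Q = sym (𝟙-no Q? (¬p ∘ Equivalence.from P⇔Q))

  𝟙-× : (P? : Dec P) (Q? : Dec Q) {x : Carrier} → 𝟙[ P? ×-dec Q? ] x ≈ 𝟙[ P? ] 𝟙[ Q? ] x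
  𝟙-× (yes _) (yes _) = refl
  𝟙-× (yes _) (no _)  = refl
  𝟙-× (no _)  _       = refl

  *-𝟙 : (P? : Dec P) (x y : Carrier) → x * (𝟙[ P? ] y) ≈ 𝟙[ P? ] (x * y)
  *-𝟙 (yes _) x y = refl
  *-𝟙 (no _)  x y = zeroʳ x

  ∑-𝟙 : (P? : Dec P) (f : A → Carrier) (xs : List A) → ∑[ x ∈ xs ] 𝟙[ P? ] f x ≈ 𝟙[ P? ] ∑ f xs
  ∑-𝟙 (yes _) f xs = refl
  ∑-𝟙 (no _)  f xs = ∑-zero xs

  ∑-filter : {P : A → Set p} (P? : Decidable P) (f : A → Carrier) (xs : List A) →
             ∑ f (filter P? xs) ≈ ∑[ x ∈ xs ] 𝟙[ P? x ] f x
  ∑-filter P? f []       = refl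
  ∑-filter P? f (x ∷ xs) with P? x
  ... | yes _ = +-congˡ (∑-filter P? f xs)
  ... | no _  = trans (∑-filter P? f xs) (sym (+-identityˡ _))

  ∑-upTo-restrict : (f : ℕ → Carrier) {w : ℕ} (m : ℕ) → w ≤ m →
                    ∑[ i ∈ upTo m ] 𝟙[ i <? w ] f i ≈ ∑ f (upTo w)
  ∑-upTo-restrict f m w≤m with m≤n⇒m<n∨m≡n w≤m
  ... | inj₂ ≡.refl = ∑-cong (applyUpTo⁺₁ id m (𝟙-yes (_ <? m)))
  ∑-upTo-restrict f {w} (suc m) _ | inj₁ (s≤s w≤m) = begin
    ∑[ i ∈ upTo (suc m) ] 𝟙[ i <? w ] f i                 ≈⟨ ∑-upTo-sucʳ _ m ⟩
    (∑[ i ∈ upTo m ] 𝟙[ i <? w ] f i) + (𝟙[ m <? w ] f m) ≈⟨ +-cong (∑-upTo-restrict f m w≤m)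
                                                                     (𝟙-no (m <? w) (≤⇒≯ w≤m)) ⟩
    ∑ f (upTo w) + 0#                                     ≈⟨ +-identityʳ _ ⟩
    ∑ f (upTo w)                                          ∎

  antidiagonalSum : ℕ → (ℕ → ℕ → Carrier) → Carrier
  antidiagonalSum zero    g = g 0 0
  antidiagonalSum (suc n) g = g 0 (suc n) + antidiagonalSum n (λ i j → g (suc i) j)

  infix 5 antidiagonalSum
  syntax antidiagonalSum n (λ i j → e) = ∑[ i + j ≡ n ] e

  antidiagonalSum-cong : ∀ n {f g : ℕ → ℕ → Carrier} → (∀ i j → i ℕ.+ j ≡ n → f i j ≈ g i j) →
                         antidiagonalSum n f ≈ antidiagonalSum n g
  antidiagonalSum-cong zero    f≈g = f≈g 0 0 ≡.refl
  antidiagonalSum-cong (suc n) f≈g =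
    +-cong (f≈g 0 (suc n) ≡.refl) (antidiagonalSum-cong n (λ i j i+j≡n → f≈g (suc i) j (≡.cong suc i+j≡n)))

  antidiagonalSum-distrib-+ : ∀ n (f g : ℕ → ℕ → Carrier) →
    ∑[ i + j ≡ n ] (f i j + g i j) ≈ antidiagonalSum n f + antidiagonalSum n g
  antidiagonalSum-distrib-+ zero    f g = refl
  antidiagonalSum-distrib-+ (suc n) f g =
    trans (+-congˡ (antidiagonalSum-distrib-+ n _ _)) (interchange _ _ _ _)

  *-distribˡ-antidiagonalSum : ∀ n x (f : ℕ → ℕ → Carrier) →
    x * antidiagonalSum n f ≈ ∑[ i + j ≡ n ] x * f i j
  *-distribˡ-antidiagonalSum zero    x f = refl
  *-distribˡ-antidiagonalSum (suc n) x f =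
    trans (distribˡ x _ _) (+-congˡ (*-distribˡ-antidiagonalSum n x _))

  antidiagonalSum-last : ∀ n (f : ℕ → ℕ → Carrier) →
    antidiagonalSum (suc n) f ≈ (∑[ i + j ≡ n ] f i (suc j)) + f (suc n) 0
  antidiagonalSum-last zero    f = refl
  antidiagonalSum-last (suc n) f =
    trans (+-congˡ (antidiagonalSum-last n (λ i j → f (suc i) j))) (sym (+-assoc _ _ _))

  ∑-upTo-antidiagonal : ∀ n (f : ℕ → ℕ → Carrier) →
                        ∑[ i ∈ upTo (suc n) ] f i (n ∸ i) ≈ antidiagonalSum n f
  ∑-upTo-antidiagonal zero    f = +-identityʳ _
  ∑-upTo-antidiagonal (suc n) f = begin
    ∑[ i ∈ upTo (suc (suc n)) ] f i (suc n ∸ i)              ≡⟨ ∑-upTo-sucˡ _ (suc n) ⟩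
    f 0 (suc n) + (∑[ i ∈ upTo (suc n) ] f (suc i) (n ∸ i))  ≈⟨ +-congˡ (∑-upTo-antidiagonal n _) ⟩
    antidiagonalSum (suc n) f                                ∎

Fits : ℕ → Diagram → Set
Fits w F = IsFerrers F × width F ≤ w

fits? : ∀ w F → Dec (Fits w F)
fits? w F = isFerrers? F ×-dec (width F ≤? w)

linked-∷⇒width≤head : ∀ {x L} → Linked _≥_ (x ∷ L) → width L ≤ x
linked-∷⇒width≤head lk = foldr-preservesᵇ ⊔-lub z≤n (All.tail (Linked⇒All (flip ≤-trans) ≤-refl lk))

width≤head⇒linked-∷ : ∀ {x} L → width L ≤ x → Linked _≥_ L → Linked _≥_ (x ∷ L)
width≤head⇒linked-∷ []      _   _  = [-]
width≤head⇒linked-∷ (y ∷ L) w≤x lk = ≤-trans (m≤m⊔n y (width L)) w≤x ∷ lk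

fits-∷ : ∀ {w x L} → Fits w (x ∷ L) ⇔ ((0 < x × x ≤ w) × Fits x L)
fits-∷ {w} {x} {L} = mk⇔ to from
  where
  to : Fits w (x ∷ L) → (0 < x × x ≤ w) × Fits x L
  to ((0<x ∷ pos , lk) , x⊔wL≤w) =
    (0<x , ≤-trans (m≤m⊔n x (width L)) x⊔wL≤w) , (pos , Linked.tail lk) , linked-∷⇒width≤head lk
  from : (0 < x × x ≤ w) × Fits x L → Fits w (x ∷ L)
  from ((0<x , x≤w) , (pos , lk) , wL≤x) =
    (0<x ∷ pos , width≤head⇒linked-∷ L wL≤x lk) , ⊔-lub x≤w (≤-trans wL≤x x≤w)

halfPerimeter≤⇔fits : ∀ {m l L} → length L ≡ l → l ≤ m →
                      (IsFerrers L × halfPerimeter L ≤ m) ⇔ Fits (m ∸ l) L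
halfPerimeter≤⇔fits ≡.refl l≤m = mk⇔ (map₂ (m+n≤o⇒m≤o∸n _)) (map₂ (m≤o∸n⇒m+n≤o _ l≤m))

listsOf-length : ∀ m l → All (λ L → length L ≡ l) (listsOf m l)
listsOf-length m zero    = ≡.refl ∷ []
listsOf-length m (suc l) =
  concat⁺ (map⁺ (applyUpTo⁺₂ id (suc m) (λ _ → map⁺ (All.map (≡.cong suc) (listsOf-length m l)))))

module FerrersGF {c ℓ} (S : CommutativeSemiring c ℓ) (q : CommutativeSemiring.Carrier S) where
  open CommutativeSemiring S
  open SemiringSums semiring
  open import Algebra.Properties.Semiring.Exp semiring using (_^_; ^-homo-*)
  open import Algebra.Properties.CommutativeSemigroup +-commutativeSemigroup
    using () renaming (interchange to +-interchange; x∙yz≈y∙xz to x+[y+z]≈y+[x+z])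
  open import Algebra.Properties.CommutativeSemigroup *-commutativeSemigroup
    using () renaming (interchange to *-interchange)
  open import Relation.Binary.Reasoning.Setoid setoid

  -- exactRows l w and box l w weigh the diagrams with exactly (resp. at most) l rows, all of
  -- length ≤ w; exactRows recurses on the length x + 1 of the first row.
  exactRows : ℕ → ℕ → Carrier
  exactRows zero    w = 1#
  exactRows (suc l) w = ∑[ x ∈ upTo w ] q ^ suc x * exactRows l (suc x)

  box : ℕ → ℕ → Carrier
  box zero    w = 1#
  box (suc l) w = box l w + exactRows (suc l) w

  hpGF : ℕ → Carrier
  hpGF n = ∑[ i + j ≡ n ] exactRows i j

  exactRows-pascal : ∀ l w →
    exactRows (suc l) (suc w) ≈ exactRows (suc l) w + q ^ suc w * exactRows l (suc w)
  exactRows-pascal l = ∑-upTo-sucʳ _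

  box-width-zero : ∀ l → box l 0 ≈ 1#
  box-width-zero zero    = refl
  box-width-zero (suc l) = trans (+-identityʳ _) (box-width-zero l)

  box-pascal : ∀ l w → box (suc l) (suc w) ≈ box (suc l) w + q ^ suc w * box l (suc w)
  box-pascal zero    w = trans (+-congˡ (exactRows-pascal 0 w)) (sym (+-assoc _ _ _))
  box-pascal (suc l) w = begin
    box (suc l) (suc w) + exactRows (suc (suc l)) (suc w)
      ≈⟨ +-cong (box-pascal l w) (exactRows-pascal (suc l) w) ⟩
    (box (suc l) w + Q * box l (suc w)) + (exactRows (suc (suc l)) w + Q * exactRows (suc l) (suc w))
      ≈⟨ +-interchange _ _ _ _ ⟩
    box (suc (suc l)) w + (Q * box l (suc w) + Q * exactRows (suc l) (suc w))
      ≈⟨ +-congˡ (sym (distribˡ Q _ _)) ⟩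
    box (suc (suc l)) w + Q * box (suc l) (suc w) ∎
    where
    Q : Carrier
    Q = q ^ suc w

  exactRows-removeFirstColumn : ∀ l w → exactRows l (suc w) ≈ q ^ l * box l w
  exactRows-removeFirstColumn zero    w       = sym (*-identityˡ 1#)
  exactRows-removeFirstColumn (suc l) zero    = begin
    q ^ 1 * exactRows l 1 + 0#  ≈⟨ +-identityʳ _ ⟩
    q ^ 1 * exactRows l 1       ≈⟨ *-congˡ (exactRows-removeFirstColumn l 0) ⟩
    q ^ 1 * (q ^ l * box l 0)   ≈⟨ sym (*-assoc _ _ _) ⟩
    (q ^ 1 * q ^ l) * box l 0   ≈⟨ *-cong (sym (^-homo-* q 1 l))
                                          (trans (box-width-zero l) (sym (box-width-zero (suc l)))) ⟩
    q ^ suc l * box (suc l) 0   ∎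
  exactRows-removeFirstColumn (suc l) (suc w) = begin
    exactRows (suc l) (suc (suc w))
      ≈⟨ exactRows-pascal l (suc w) ⟩
    exactRows (suc l) (suc w) + (q * q ^ suc w) * exactRows l (suc (suc w))
      ≈⟨ +-cong (exactRows-removeFirstColumn (suc l) w) (*-congˡ (exactRows-removeFirstColumn l (suc w))) ⟩
    q ^ suc l * box (suc l) w + (q * q ^ suc w) * (q ^ l * box l (suc w))
      ≈⟨ +-congˡ (*-interchange _ _ _ _) ⟩
    q ^ suc l * box (suc l) w + q ^ suc l * (q ^ suc w * box l (suc w))
      ≈⟨ sym (distribˡ _ _ _) ⟩
    q ^ suc l * (box (suc l) w + q ^ suc w * box l (suc w))
      ≈⟨ *-congˡ (sym (box-pascal l w)) ⟩
    q ^ suc l * box (suc l) (suc w) ∎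

  antidiagonalSum-removeHook : ∀ n →
    ∑[ i + j ≡ n ] q ^ suc j * exactRows i (suc j) ≈ q ^ suc n * (∑[ i + j ≡ n ] box i j)
  antidiagonalSum-removeHook n = begin
    ∑[ i + j ≡ n ] q ^ suc j * exactRows i (suc j)  ≈⟨ antidiagonalSum-cong n hook ⟩
    ∑[ i + j ≡ n ] q ^ suc n * box i j              ≈⟨ sym (*-distribˡ-antidiagonalSum n _ box) ⟩
    q ^ suc n * (∑[ i + j ≡ n ] box i j)            ∎
    where
    hook : ∀ i j → i ℕ.+ j ≡ n → q ^ suc j * exactRows i (suc j) ≈ q ^ suc n * box i j
    hook i j i+j≡n = begin
      q ^ suc j * exactRows i (suc j)  ≈⟨ *-congˡ (exactRows-removeFirstColumn i j) ⟩
      q ^ suc j * (q ^ i * box i j)    ≈⟨ sym (*-assoc _ _ _) ⟩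
      (q ^ suc j * q ^ i) * box i j    ≈⟨ *-congʳ (sym (^-homo-* q (suc j) i)) ⟩
      q ^ (suc j ℕ.+ i) * box i j      ≡⟨ ≡.cong (λ k → q ^ suc k * box i j) (≡.trans (ℕ.+-comm j i) i+j≡n) ⟩
      q ^ suc n * box i j              ∎

  antidiagonalSum-box : ∀ n → ∑[ i + j ≡ n ] box i j ≈ ∑ hpGF (upTo (suc n))
  antidiagonalSum-box zero    = sym (+-identityʳ 1#)
  antidiagonalSum-box (suc n) = begin
    1# + (∑[ i + j ≡ n ] (box i j + exactRows (suc i) j))
      ≈⟨ +-congˡ (antidiagonalSum-distrib-+ n box _) ⟩
    1# + (antidiagonalSum n box + (∑[ i + j ≡ n ] exactRows (suc i) j))
      ≈⟨ x+[y+z]≈y+[x+z] _ _ _ ⟩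
    antidiagonalSum n box + hpGF (suc n)
      ≈⟨ +-congʳ (antidiagonalSum-box n) ⟩
    ∑ hpGF (upTo (suc n)) + hpGF (suc n)
      ≈⟨ sym (∑-upTo-sucʳ hpGF (suc n)) ⟩
    ∑ hpGF (upTo (suc (suc n))) ∎

  hpGF-suc : ∀ n → hpGF (suc n) ≈ hpGF n + q ^ n * ∑ hpGF (upTo n)
  hpGF-suc zero    = +-congˡ (sym (zeroʳ 1#))
  hpGF-suc (suc n) = begin
    1# + antidiagonalSum (suc n) (λ i j → exactRows (suc i) j)
      ≈⟨ +-congˡ (trans (antidiagonalSum-last n (λ i j → exactRows (suc i) j)) (+-identityʳ _)) ⟩
    1# + (∑[ i + j ≡ n ] exactRows (suc i) (suc j))
      ≈⟨ +-congˡ (antidiagonalSum-cong n (λ i j _ → exactRows-pascal i j)) ⟩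
    1# + (∑[ i + j ≡ n ] (exactRows (suc i) j + q ^ suc j * exactRows i (suc j)))
      ≈⟨ +-congˡ (antidiagonalSum-distrib-+ n _ _) ⟩
    1# + ((∑[ i + j ≡ n ] exactRows (suc i) j) + (∑[ i + j ≡ n ] q ^ suc j * exactRows i (suc j)))
      ≈⟨ sym (+-assoc _ _ _) ⟩
    hpGF (suc n) + (∑[ i + j ≡ n ] q ^ suc j * exactRows i (suc j))
      ≈⟨ +-congˡ (antidiagonalSum-removeHook n) ⟩
    hpGF (suc n) + q ^ suc n * (∑[ i + j ≡ n ] box i j)
      ≈⟨ +-congˡ (*-congˡ (antidiagonalSum-box n)) ⟩
    hpGF (suc n) + q ^ suc n * ∑ hpGF (upTo (suc n)) ∎

  ∑-listsOf-fits : ∀ {m} l {w} → w ≤ m →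
                   ∑[ L ∈ listsOf m l ] 𝟙[ fits? w L ] q ^ area L ≈ exactRows l w
  ∑-listsOf-fits         zero    {w} _   = trans (+-identityʳ _) (𝟙-yes (fits? w []) (([] , []) , z≤n))
  ∑-listsOf-fits {m = m} (suc l) {w} w≤m = begin
    ∑[ L ∈ listsOf m (suc l) ] 𝟙[ fits? w L ] q ^ area L
      ≈⟨ ∑-concatMap (λ L → 𝟙[ fits? w L ] q ^ area L) (λ x → map (x ∷_) (listsOf m l)) (upTo (suc m)) ⟩
    ∑[ x ∈ upTo (suc m) ] ∑[ L ∈ map (x ∷_) (listsOf m l) ] 𝟙[ fits? w L ] q ^ area L
      ≈⟨ ∑-cong (applyUpTo⁺₁ id (suc m) (λ { (s≤s x≤m) → firstRow x≤m })) ⟩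
    ∑[ x ∈ upTo (suc m) ] 𝟙[ row? x ] startingWith x
      ≡⟨ ∑-upTo-sucˡ _ m ⟩
    (𝟙[ row? 0 ] startingWith 0) + (∑[ x ∈ upTo m ] 𝟙[ row? (suc x) ] startingWith (suc x))
      ≈⟨ +-cong (𝟙-no (row? 0) {startingWith 0} (λ ())) (∑-cong (All.universal (λ x → row?-suc x) (upTo m))) ⟩
    0# + (∑[ x ∈ upTo m ] 𝟙[ x <? w ] startingWith (suc x))
      ≈⟨ +-identityˡ _ ⟩
    ∑[ x ∈ upTo m ] 𝟙[ x <? w ] startingWith (suc x)
      ≈⟨ ∑-upTo-restrict _ m w≤m ⟩
    exactRows (suc l) w ∎
    where
    startingWith : ℕ → Carrier
    startingWith x = q ^ x * exactRows l x

    row? : ∀ x → Dec (0 < x × x ≤ w)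
    row? x = (0 <? x) ×-dec (x ≤? w)

    row?-suc : ∀ x {y} → 𝟙[ row? (suc x) ] y ≈ 𝟙[ x <? w ] y
    row?-suc x = 𝟙-⇔ (row? (suc x)) (x <? w) (mk⇔ proj₂ (s≤s z≤n ,_))

    splitFirstRow : ∀ x L →
      𝟙[ fits? w (x ∷ L) ] q ^ area (x ∷ L) ≈ 𝟙[ row? x ] (q ^ x * (𝟙[ fits? x L ] q ^ area L))
    splitFirstRow x L = begin
      𝟙[ fits? w (x ∷ L) ] q ^ (x ℕ.+ area L)
        ≈⟨ 𝟙-⇔ (fits? w (x ∷ L)) (row? x ×-dec fits? x L) fits-∷ ⟩
      𝟙[ row? x ×-dec fits? x L ] q ^ (x ℕ.+ area L)
        ≈⟨ 𝟙-× (row? x) (fits? x L) ⟩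
      𝟙[ row? x ] 𝟙[ fits? x L ] q ^ (x ℕ.+ area L)
        ≈⟨ 𝟙-cong (row? x) (𝟙-cong (fits? x L) (^-homo-* q x (area L))) ⟩
      𝟙[ row? x ] 𝟙[ fits? x L ] (q ^ x * q ^ area L)
        ≈⟨ 𝟙-cong (row? x) (sym (*-𝟙 (fits? x L) _ _)) ⟩
      𝟙[ row? x ] (q ^ x * (𝟙[ fits? x L ] q ^ area L)) ∎

    firstRow : ∀ {x} → x ≤ m →
      ∑[ L ∈ map (x ∷_) (listsOf m l) ] 𝟙[ fits? w L ] q ^ area L ≈ 𝟙[ row? x ] startingWith x
    firstRow {x} x≤m = begin
      ∑[ L ∈ map (x ∷_) (listsOf m l) ] 𝟙[ fits? w L ] q ^ area L
        ≡⟨ ∑-map _ _ (listsOf m l) ⟩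
      ∑[ L ∈ listsOf m l ] 𝟙[ fits? w (x ∷ L) ] q ^ area (x ∷ L)
        ≈⟨ ∑-cong (All.universal (splitFirstRow x) (listsOf m l)) ⟩
      ∑[ L ∈ listsOf m l ] 𝟙[ row? x ] (q ^ x * (𝟙[ fits? x L ] q ^ area L))
        ≈⟨ ∑-𝟙 (row? x) _ (listsOf m l) ⟩
      𝟙[ row? x ] (∑[ L ∈ listsOf m l ] q ^ x * (𝟙[ fits? x L ] q ^ area L))
        ≈⟨ 𝟙-cong (row? x) (sym (*-distribˡ-∑ _ _ (listsOf m l))) ⟩
      𝟙[ row? x ] (q ^ x * (∑[ L ∈ listsOf m l ] 𝟙[ fits? x L ] q ^ area L))
        ≈⟨ 𝟙-cong (row? x) (*-congˡ (∑-listsOf-fits l x≤m)) ⟩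
      𝟙[ row? x ] startingWith x ∎

  ∑-ferrersUpTo≈hpGF : ∀ m → ∑[ F ∈ ferrersUpTo m ] q ^ area F ≈ hpGF m
  ∑-ferrersUpTo≈hpGF m = begin
    ∑[ F ∈ ferrersUpTo m ] q ^ area F
      ≈⟨ ∑-filter within? (λ F → q ^ area F) (candidates m) ⟩
    ∑[ F ∈ candidates m ] 𝟙[ within? F ] q ^ area F
      ≈⟨ ∑-concatMap (λ F → 𝟙[ within? F ] q ^ area F) (listsOf m) (upTo (suc m)) ⟩
    ∑[ l ∈ upTo (suc m) ] ∑[ L ∈ listsOf m l ] 𝟙[ within? L ] q ^ area L
      ≈⟨ ∑-cong (applyUpTo⁺₁ id (suc m) (λ { (s≤s l≤m) → rows l≤m })) ⟩
    ∑[ l ∈ upTo (suc m) ] exactRows l (m ∸ l)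
      ≈⟨ ∑-upTo-antidiagonal m exactRows ⟩
    hpGF m ∎
    where
    within? : ∀ F → Dec (IsFerrers F × halfPerimeter F ≤ m)
    within? F = isFerrers? F ×-dec (halfPerimeter F ≤? m)

    rows : ∀ {l} → l ≤ m → ∑[ L ∈ listsOf m l ] 𝟙[ within? L ] q ^ area L ≈ exactRows l (m ∸ l)
    rows {l} l≤m = begin
      ∑[ L ∈ listsOf m l ] 𝟙[ within? L ] q ^ area L
        ≈⟨ ∑-cong (All.map (λ {L} len → 𝟙-⇔ (within? L) (fits? (m ∸ l) L)
                                                 (halfPerimeter≤⇔fits len l≤m))
                           (listsOf-length m l)) ⟩
      ∑[ L ∈ listsOf m l ] 𝟙[ fits? (m ∸ l) L ] q ^ area L
        ≈⟨ ∑-listsOf-fits l (m∸n≤m m l) ⟩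
      exactRows l (m ∸ l) ∎

module _ {c ℓ} (R : CommutativeRing c ℓ) where
  open CommutativeRing R
  open import Algebra.Properties.Semiring.Exp semiring using (_^_)
  open import Algebra.Properties.Ring ring using ([y-z]x≈yx-zx; //-rightDividesʳ)
  open import Algebra.Solver.Ring.NaturalCoefficients.Default commutativeSemiring
    using (solve; _:=_; _:+_; _:*_)
  open import Relation.Binary.Reasoning.Setoid setoid

  partialSums⇒threeTermRecurrence : ∀ q (d s : ℕ → Carrier) →
    (∀ n → s (suc n) ≈ s n + d n) → (∀ n → d (suc n) ≈ d n + q ^ n * s n) →
    ∀ n → d (suc (suc n)) ≈ (1# + q) * d (suc n) + (q ^ suc n - q) * d n
  partialSums⇒threeTermRecurrence q d s s-suc d-suc n = begin
    d (suc (suc n))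
      ≈⟨ sym (//-rightDividesʳ (q * e) _) ⟩
    (d (suc (suc n)) + q * e) - q * e
      ≈⟨ +-congʳ added ⟩
    ((1# + q) * d (suc n) + q ^ suc n * e) - q * e
      ≈⟨ +-assoc _ _ _ ⟩
    (1# + q) * d (suc n) + (q ^ suc n * e - q * e)
      ≈⟨ +-congˡ (sym ([y-z]x≈yx-zx e _ _)) ⟩
    (1# + q) * d (suc n) + (q ^ suc n - q) * e ∎
    where
    e p x : Carrier
    e = d n
    p = q ^ n
    x = s n

    regroup : ∀ q p x e →
      ((e + p * x) + (q * p) * (x + e)) + q * e ≈ ((e + p * x) + q * (e + p * x)) + (q * p) * e
    regroup = solve 4 (λ q p x e →
        ((e :+ p :* x) :+ (q :* p) :* (x :+ e)) :+ q :* e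
      := ((e :+ p :* x) :+ q :* (e :+ p :* x)) :+ (q :* p) :* e) refl

    -- Adding q * e to both sides makes the identity subtraction-free, so the semiring solver applies.
    added : d (suc (suc n)) + q * e ≈ (1# + q) * d (suc n) + q ^ suc n * e
    added = begin
      d (suc (suc n)) + q * e
        ≈⟨ +-congʳ (trans (d-suc (suc n)) (+-cong (d-suc n) (*-congˡ (s-suc n)))) ⟩
      ((e + p * x) + (q * p) * (x + e)) + q * e
        ≈⟨ regroup q p x e ⟩
      ((e + p * x) + q * (e + p * x)) + (q * p) * e
        ≈⟨ +-congʳ (+-cong (sym (d-suc n)) (*-congˡ (sym (d-suc n)))) ⟩
      (d (suc n) + q * d (suc n)) + (q * p) * e
        ≈⟨ +-congʳ (sym (trans (distribʳ _ 1# q) (+-congʳ (*-identityˡ _)))) ⟩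
      (1# + q) * d (suc n) + q ^ suc n * e ∎

mainTheorem8 : ∀ {c ℓ} (R : CommutativeRing c ℓ) (q : CommutativeRing.Carrier R) →
    let open CommutativeRing R
    in ((n : ℕ) → D R q (suc n) ≈ D R q n + pow R q n * sumD R q n)
       × ((n : ℕ) → D R q (suc (suc n)) ≈ (1# + q) * D R q (suc n) + (pow R q (suc n) - q) * D R q n)
mainTheorem8 R q = recurrence , partialSums⇒threeTermRecurrence R q (D R q) (sumD R q) sumD-suc recurrence
  where
  open CommutativeRing R
  open SemiringSums semiring using (∑; ∑-cong; ∑-upTo-sucʳ)
  open FerrersGF commutativeSemiring q
  open import Relation.Binary.Reasoning.Setoid setoid

  sumD-suc : ∀ n → sumD R q (suc n) ≈ sumD R q n + D R q n
  sumD-suc = ∑-upTo-sucʳ (D R q)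

  sumD≈∑hpGF : ∀ n → sumD R q n ≈ ∑ hpGF (upTo n)
  sumD≈∑hpGF n = ∑-cong (All.universal ∑-ferrersUpTo≈hpGF (upTo n))

  recurrence : ∀ n → D R q (suc n) ≈ D R q n + pow R q n * sumD R q n
  recurrence n = begin
    D R q (suc n)                         ≈⟨ ∑-ferrersUpTo≈hpGF (suc n) ⟩
    hpGF (suc n)                          ≈⟨ hpGF-suc n ⟩
    hpGF n + pow R q n * ∑ hpGF (upTo n)  ≈⟨ sym (+-cong (∑-ferrersUpTo≈hpGF n) (*-congˡ (sumD≈∑hpGF n))) ⟩
    D R q n + pow R q n * sumD R q n      ∎
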